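{- Let $p$ be a prime and $n,r\geq 0$ integers. Then \[ B_{n+p^r,-r}\equiv B_{n,-r+1}\pmod p. \]
   Context: For every integer $r\in\mathbb{Z}$, the $r$-Bell numbers $B_{n,r}$ are defined by $\sum_{n\geq 0}B_{n,r}\frac{t^n}{n!}=e^{e^t-1+rt}$. -}

module Defs where

open import Data.Nat using (ℕ; zero; suc)
import Data.Nat as ℕ
open import Data.Nat.Combinatorics using (_C_)
open import Data.Integer using (ℤ; +_; _+_; _*_; _^_; -_; _-_)

sumTo : ℕ → (ℕ → ℤ) → ℤ
sumTo zero    f = f 0
sumTo (suc n) f = sumTo n f + f (suc n)

stirling2 : ℕ → ℕ → ℕ
stirling2 zero    zero    = 1
stirling2 zero    (suc k) = 0
stirling2 (suc n) zero    = 0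
stirling2 (suc n) (suc k) = suc k ℕ.* stirling2 n (suc k) ℕ.+ stirling2 n k

bell : ℕ → ℤ
bell n = sumTo n (λ k → + stirling2 n k)

-- r-Bell numbers, r ∈ ℤ:  egf e^{e^t-1+rt} = e^{e^t-1} · e^{rt},
-- so by the product rule for egfs  B_{n,r} = Σ_j C(n,j) r^{n-j} B_j.
rBell : ℕ → ℤ → ℤ
rBell n r = sumTo n (λ j → + (n C j) * (r ^ (n ℕ.∸ j)) * bell j)

-- Let L be the linear functional on ℤ[x] with L((x)ₖ) = 1 on the falling factorials; then
-- B_{n,c} = L((x + c)ⁿ) and L(x f(x)) = L(f(x + 1)), whence B_{n+1,c} = B_{n,c+1} + c B_{n,c}.
-- Modulo p one has (x + c)ᵖ ≡ x + c + (x)ₚ in the falling-factorial basis, and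
-- L((x)ₚ f(x - p)) = L(f), which gives Touchard's congruence B_{n+p,c} ≡ B_{n+1,c} + B_{n,c}:
-- on the sequence n ↦ B_{n,c} the shift S satisfies Sᵖ ≡ S + 1.  Since (S + s)ᵖ ≡ Sᵖ + s
-- modulo p, induction gives S^(pʳ) ≡ S + r, and for c = -r this reads
-- B_{n+pʳ,-r} ≡ B_{n+1,-r} + r B_{n,-r} = B_{n,1-r}.
module Submission where

open import Defs
open import Data.Nat using (ℕ; _^_)
import Data.Nat as ℕ
open import Data.Nat.Primality using (Prime)
open import Data.Integer using (ℤ; +_; -_; _-_)
open import Data.Integer.Divisibility using (_∣_)

open import Data.Nat using (zero; suc; _≤_; _<_; _≤′_; ≤′-refl; ≤′-step; z≤n; s≤s; nonTrivial⇒n>1)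
import Data.Nat.Properties as ℕP
open import Data.Nat.Combinatorics using (_C_; nCk+nC[k+1]≡[n+1]C[k+1]; k>n⇒nCk≡0; nC1≡n; nCn≡1)
import Data.Nat.Divisibility as ℕD
import Data.Nat.Coprimality as ℕC
open import Data.Nat.Primality using (prime⇒nonTrivial)
open import Data.Nat.Tactic.RingSolver using () renaming (solve-∀ to ℕ-solve-∀)
open import Data.Integer using (0ℤ; 1ℤ; -[1+_]; _+_; _*_) renaming (_^_ to _^ℤ_)
import Data.Integer.Properties as ℤP
import Data.Integer.Divisibility.Signed as S
import Data.Integer.Coprimality as ℤC
open import Data.Integer.Tactic.RingSolver using (solve-∀)
open import Data.Product using (_,_)
open import Function using (_∘_)
open import Relation.Nullary using (yes; no)
open import Relation.Binary.Bundles using (Setoid)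
open import Relation.Binary.Structures using (IsEquivalence)
open import Relation.Binary.PropositionalEquality
import Relation.Binary.Reasoning.Setoid as ≈-Reasoning

sumTo-cong : ∀ n {f g : ℕ → ℤ} → (∀ i → i ≤ n → f i ≡ g i) → sumTo n f ≡ sumTo n g
sumTo-cong zero    f≗g = f≗g 0 z≤n
sumTo-cong (suc n) f≗g =
  cong₂ _+_ (sumTo-cong n (λ i i≤n → f≗g i (ℕP.m≤n⇒m≤1+n i≤n))) (f≗g (suc n) ℕP.≤-refl)

sumTo-+ : ∀ n (f g : ℕ → ℤ) → sumTo n (λ i → f i + g i) ≡ sumTo n f + sumTo n g
sumTo-+ zero    f g = refl
sumTo-+ (suc n) f g =
  trans (cong (_+ (f (suc n) + g (suc n))) (sumTo-+ n f g))
        (interchange (sumTo n f) (sumTo n g) (f (suc n)) (g (suc n)))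
  where
  interchange : ∀ a b c d → (a + b) + (c + d) ≡ (a + c) + (b + d)
  interchange = solve-∀

sumTo-*ˡ : ∀ n c (f : ℕ → ℤ) → sumTo n (λ i → c * f i) ≡ c * sumTo n f
sumTo-*ˡ zero    c f = refl
sumTo-*ˡ (suc n) c f =
  trans (cong (_+ c * f (suc n)) (sumTo-*ˡ n c f)) (sym (ℤP.*-distribˡ-+ c (sumTo n f) (f (suc n))))

sumTo-suc : ∀ n (f : ℕ → ℤ) → sumTo (suc n) f ≡ f 0 + sumTo n (f ∘ suc)
sumTo-suc zero    f = refl
sumTo-suc (suc n) f = trans (cong (_+ f (suc (suc n))) (sumTo-suc n f)) (ℤP.+-assoc (f 0) _ _)

sumTo-0ℤ : ∀ n → sumTo n (λ _ → 0ℤ) ≡ 0ℤ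
sumTo-0ℤ zero    = refl
sumTo-0ℤ (suc n) = cong (_+ 0ℤ) (sumTo-0ℤ n)

sumTo-extend : ∀ {m n} {f : ℕ → ℤ} → m ≤′ n → (∀ i → m < i → f i ≡ 0ℤ) → sumTo n f ≡ sumTo m f
sumTo-extend ≤′-refl            f>m≡0 = refl
sumTo-extend (≤′-step {n} m≤′n) f>m≡0 =
  trans (cong₂ _+_ (sumTo-extend m≤′n f>m≡0) (f>m≡0 (suc n) (s≤s (ℕP.≤′⇒≤ m≤′n))))
        (ℤP.+-identityʳ _)

sumTo-comm : ∀ m n (f : ℕ → ℕ → ℤ) →
             sumTo m (λ i → sumTo n (f i)) ≡ sumTo n (λ j → sumTo m (λ i → f i j))
sumTo-comm zero    n f = refl
sumTo-comm (suc m) n f =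
  trans (cong (_+ sumTo n (f (suc m))) (sumTo-comm m n f))
        (sym (sumTo-+ n (λ j → sumTo m (λ i → f i j)) (f (suc m))))

sumTo-pascal : ∀ n (g : ℕ → ℤ) →
  sumTo (suc n) (λ i → + (suc n C i) * g i)
    ≡ sumTo n (λ i → + (n C i) * g i) + sumTo n (λ i → + (n C i) * g (suc i))
sumTo-pascal n g = begin
  sumTo (suc n) (λ i → + (suc n C i) * g i)
    ≡⟨ sumTo-suc n _ ⟩
  1ℤ * g 0 + sumTo n (λ i → + (suc n C suc i) * g (suc i))
    ≡⟨ cong (_+_ (1ℤ * g 0)) (sumTo-cong n (λ i _ → pascal i)) ⟩
  1ℤ * g 0 + sumTo n (λ i → A i + B i)
    ≡⟨ cong (_+_ (1ℤ * g 0)) (sumTo-+ n A B) ⟩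
  1ℤ * g 0 + (sumTo n A + sumTo n B)
    ≡⟨ reassoc (1ℤ * g 0) (sumTo n A) (sumTo n B) ⟩
  (1ℤ * g 0 + sumTo n B) + sumTo n A
    ≡⟨ cong (_+ sumTo n A) lower ⟩
  sumTo n h + sumTo n A
    ∎
  where
  open ≡-Reasoning
  A B : ℕ → ℤ
  A i = + (n C i) * g (suc i)
  B i = + (n C suc i) * g (suc i)
  pascal : ∀ i → + (suc n C suc i) * g (suc i) ≡ A i + B i
  pascal i = begin
    + (suc n C suc i) * g (suc i)              ≡⟨ cong (λ k → + k * g (suc i)) (sym (nCk+nC[k+1]≡[n+1]C[k+1] n i)) ⟩
    + (n C i ℕ.+ n C suc i) * g (suc i)        ≡⟨ cong (_* g (suc i)) (ℤP.pos-+ (n C i) (n C suc i)) ⟩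
    (+ (n C i) + + (n C suc i)) * g (suc i)    ≡⟨ ℤP.*-distribʳ-+ (g (suc i)) (+ (n C i)) (+ (n C suc i)) ⟩
    A i + B i                                  ∎
  reassoc : ∀ a x y → a + (x + y) ≡ (a + y) + x
  reassoc = solve-∀
  h : ℕ → ℤ
  h i = + (n C i) * g i
  lower : 1ℤ * g 0 + sumTo n B ≡ sumTo n h
  lower = begin
    1ℤ * g 0 + sumTo n B      ≡⟨ sym (sumTo-suc n h) ⟩
    sumTo (suc n) h           ≡⟨ sumTo-extend {f = h} (≤′-step ≤′-refl) (λ i n<i → cong (λ k → + k * g i)
                                                                                     (k>n⇒nCk≡0 n<i)) ⟩
    sumTo n h                 ∎

[k+1]*[n+1]C[k+1]≡[n+1]*nCk : ∀ n k → suc k ℕ.* (suc n C suc k) ≡ suc n ℕ.* (n C k)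
[k+1]*[n+1]C[k+1]≡[n+1]*nCk n       zero    =
  trans (ℕP.+-identityʳ _) (trans (nC1≡n (suc n)) (sym (ℕP.*-identityʳ (suc n))))
[k+1]*[n+1]C[k+1]≡[n+1]*nCk zero    (suc k) = ℕP.*-zeroʳ (suc (suc k))
[k+1]*[n+1]C[k+1]≡[n+1]*nCk (suc n) (suc k) = begin
  suc (suc k) ℕ.* (suc (suc n) C suc (suc k))
    ≡⟨ cong (suc (suc k) ℕ.*_) (sym (nCk+nC[k+1]≡[n+1]C[k+1] (suc n) (suc k))) ⟩
  suc (suc k) ℕ.* (x ℕ.+ y)
    ≡⟨ expand k x y ⟩
  suc k ℕ.* x ℕ.+ suc (suc k) ℕ.* y ℕ.+ x
    ≡⟨ cong₂ (λ u v → u ℕ.+ v ℕ.+ x) ([k+1]*[n+1]C[k+1]≡[n+1]*nCk n k)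
                                     ([k+1]*[n+1]C[k+1]≡[n+1]*nCk n (suc k)) ⟩
  suc n ℕ.* (n C k) ℕ.+ suc n ℕ.* (n C suc k) ℕ.+ x
    ≡⟨ cong (ℕ._+ x) (sym (ℕP.*-distribˡ-+ (suc n) (n C k) (n C suc k))) ⟩
  suc n ℕ.* (n C k ℕ.+ n C suc k) ℕ.+ x
    ≡⟨ cong (λ u → suc n ℕ.* u ℕ.+ x) (nCk+nC[k+1]≡[n+1]C[k+1] n k) ⟩
  suc n ℕ.* x ℕ.+ x
    ≡⟨ ℕP.+-comm (suc n ℕ.* x) x ⟩
  suc (suc n) ℕ.* x
    ∎
  where
  open ≡-Reasoning
  x y : ℕ
  x = suc n C suc k
  y = suc n C suc (suc k)
  expand : ∀ k x y → suc (suc k) ℕ.* (x ℕ.+ y) ≡ suc k ℕ.* x ℕ.+ suc (suc k) ℕ.* y ℕ.+ x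
  expand = ℕ-solve-∀

Seq : Set
Seq = ℕ → ℤ

-- shiftAdd c is the operator S + c, where S b j = b (suc j) is the shift.
shiftAdd : ℤ → Seq → Seq
shiftAdd c b j = b (suc j) + c * b j

shiftAdd^ : ℤ → ℕ → Seq → Seq
shiftAdd^ c zero    b = b
shiftAdd^ c (suc n) b = shiftAdd c (shiftAdd^ c n b)

shiftAdd^-suc : ∀ c n b j → shiftAdd^ c (suc n) b j ≡ shiftAdd^ c n (shiftAdd c b) j
shiftAdd^-suc c zero    b j = refl
shiftAdd^-suc c (suc n) b j =
  cong₂ (λ x y → x + c * y) (shiftAdd^-suc c n b (suc j)) (shiftAdd^-suc c n b j)

shiftAdd^-+ : ∀ c {b u v : Seq} → (∀ j → b j ≡ u j + v j) →
              ∀ n j → shiftAdd^ c n b j ≡ shiftAdd^ c n u j + shiftAdd^ c n v j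
shiftAdd^-+ c b≗u+v zero    j = b≗u+v j
shiftAdd^-+ c {u = u} {v} b≗u+v (suc n) j =
  trans (cong₂ (λ x y → x + c * y) (shiftAdd^-+ c b≗u+v n (suc j)) (shiftAdd^-+ c b≗u+v n j))
        (distrib c (shiftAdd^ c n u (suc j)) (shiftAdd^ c n v (suc j)) (shiftAdd^ c n u j) (shiftAdd^ c n v j))
  where
  distrib : ∀ c u′ v′ u v → (u′ + v′) + c * (u + v) ≡ (u′ + c * u) + (v′ + c * v)
  distrib = solve-∀

shiftAdd^-* : ∀ c a {b u : Seq} → (∀ j → b j ≡ a * u j) →
              ∀ n j → shiftAdd^ c n b j ≡ a * shiftAdd^ c n u j
shiftAdd^-* c a b≗au zero    j = b≗au j
shiftAdd^-* c a {u = u} b≗au (suc n) j =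
  trans (cong₂ (λ x y → x + c * y) (shiftAdd^-* c a b≗au n (suc j)) (shiftAdd^-* c a b≗au n j))
        (distrib c a (shiftAdd^ c n u (suc j)) (shiftAdd^ c n u j))
  where
  distrib : ∀ c a u′ u → a * u′ + c * (a * u) ≡ a * (u′ + c * u)
  distrib = solve-∀

shiftAdd^-expand : ∀ c n b j →
  shiftAdd^ c n b j ≡ sumTo n (λ i → + (n C i) * (c ^ℤ (n ℕ.∸ i) * b (j ℕ.+ i)))
shiftAdd^-expand c zero    b j =
  sym (trans (ℤP.*-identityˡ _) (trans (ℤP.*-identityˡ _) (cong b (ℕP.+-identityʳ j))))
shiftAdd^-expand c (suc n) b j = begin
  shiftAdd^ c n b (suc j) + c * shiftAdd^ c n b j
    ≡⟨ cong₂ (λ x y → x + c * y) (shiftAdd^-expand c n b (suc j)) (shiftAdd^-expand c n b j) ⟩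
  sumTo n (λ i → + (n C i) * (c ^ℤ (n ℕ.∸ i) * b (suc j ℕ.+ i))) + c * sumTo n term
    ≡⟨ ℤP.+-comm _ (c * sumTo n term) ⟩
  c * sumTo n term + sumTo n (λ i → + (n C i) * (c ^ℤ (n ℕ.∸ i) * b (suc j ℕ.+ i)))
    ≡⟨ cong₂ _+_ (trans (sym (sumTo-*ˡ n c term)) (sumTo-cong n absorb))
                 (sumTo-cong n (λ i _ → cong (λ k → + (n C i) * (c ^ℤ (n ℕ.∸ i) * b k)) (sym (ℕP.+-suc j i)))) ⟩
  sumTo n (λ i → + (n C i) * g i) + sumTo n (λ i → + (n C i) * g (suc i))
    ≡⟨ sym (sumTo-pascal n g) ⟩
  sumTo (suc n) (λ i → + (suc n C i) * g i)
    ∎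
  where
  open ≡-Reasoning
  term g : ℕ → ℤ
  term i = + (n C i) * (c ^ℤ (n ℕ.∸ i) * b (j ℕ.+ i))
  g i = c ^ℤ (suc n ℕ.∸ i) * b (j ℕ.+ i)
  rearrange : ∀ c k x y → c * (k * (x * y)) ≡ k * ((c * x) * y)
  rearrange = solve-∀
  absorb : ∀ i → i ≤ n → c * term i ≡ + (n C i) * g i
  absorb i i≤n = trans (rearrange c (+ (n C i)) (c ^ℤ (n ℕ.∸ i)) (b (j ℕ.+ i)))
                       (cong (λ e → + (n C i) * (c ^ℤ e * b (j ℕ.+ i))) (sym (ℕP.+-∸-assoc 1 i≤n)))

shiftAdd^-geometric : ∀ c k n j → shiftAdd^ c n (k ^ℤ_) j ≡ (c + k) ^ℤ n * k ^ℤ j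
shiftAdd^-geometric c k zero    j = sym (ℤP.*-identityˡ (k ^ℤ j))
shiftAdd^-geometric c k (suc n) j =
  trans (cong₂ (λ x y → x + c * y) (shiftAdd^-geometric c k n (suc j)) (shiftAdd^-geometric c k n j))
        (collect c k ((c + k) ^ℤ n) (k ^ℤ j))
  where
  collect : ∀ c k x y → x * (k * y) + c * (x * y) ≡ ((c + k) * x) * y
  collect = solve-∀

-- A sequence f stands for the polynomial Σ f k (x)ₖ in the falling-factorial basis
-- (x)ₖ = x (x - 1) ⋯ (x - k + 1), where x (x)ₖ = (x)ₖ₊₁ + k (x)ₖ and (x + 1)ₖ = (x)ₖ + k (x)ₖ₋₁.
δ₀ : Seq
δ₀ zero    = 1ℤ
δ₀ (suc k) = 0ℤ

mul-x+ : ℤ → Seq → Seq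
mul-x+ c f zero    = c * f 0
mul-x+ c f (suc k) = f k + (c + + suc k) * f (suc k)

translate₁ : Seq → Seq
translate₁ f k = f k + + suc k * f (suc k)

-- raise t f stands for (x)ₜ f(x - t), since (x)ₜ (x - t)ⱼ = (x)ₜ₊ⱼ.
raise : ℕ → Seq → Seq
raise zero    f k       = f k
raise (suc t) f zero    = 0ℤ
raise (suc t) f (suc k) = raise t f k

-- rStirling c n stands for (x + c)ⁿ; for c = r ≥ 0 its coefficients are the r-Stirling numbers.
rStirling : ℤ → ℕ → Seq
rStirling c zero    = δ₀
rStirling c (suc n) = mul-x+ c (rStirling c n)

raise-below : ∀ t f {k} → k < t → raise t f k ≡ 0ℤ
raise-below (suc t) f {zero}  _         = refl
raise-below (suc t) f {suc k} (s≤s k<t) = raise-below t f k<t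

raise-above : ∀ t f j → raise t f (t ℕ.+ j) ≡ f j
raise-above zero    f j = refl
raise-above (suc t) f j = raise-above t f j

sumTo-raise : ∀ t n f → sumTo (t ℕ.+ n) (raise t f) ≡ sumTo n f
sumTo-raise zero    n f = refl
sumTo-raise (suc t) n f =
  trans (sumTo-suc (t ℕ.+ n) (raise (suc t) f)) (trans (ℤP.+-identityˡ _) (sumTo-raise t n f))

mul-x+-cong : ∀ c {f g : Seq} → (∀ k → f k ≡ g k) → ∀ k → mul-x+ c f k ≡ mul-x+ c g k
mul-x+-cong c f≗g zero    = cong (c *_) (f≗g 0)
mul-x+-cong c f≗g (suc k) = cong₂ (λ x y → x + (c + + suc k) * y) (f≗g k) (f≗g (suc k))

mul-x+-split : ∀ c f k → mul-x+ c f k ≡ mul-x+ 0ℤ f k + c * f k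
mul-x+-split c f zero    = sym (ℤP.+-identityˡ (c * f 0))
mul-x+-split c f (suc k) = split c (+ suc k) (f k) (f (suc k))
  where
  split : ∀ c s x y → x + (c + s) * y ≡ (x + (0ℤ + s) * y) + c * y
  split = solve-∀

mul-x+-+ : ∀ c f g k → mul-x+ c (λ i → f i + g i) k ≡ mul-x+ c f k + mul-x+ c g k
mul-x+-+ c f g zero    = ℤP.*-distribˡ-+ c (f 0) (g 0)
mul-x+-+ c f g (suc k) = distrib (c + + suc k) (f k) (g k) (f (suc k)) (g (suc k))
  where
  distrib : ∀ a x y u v → (x + y) + a * (u + v) ≡ (x + a * u) + (y + a * v)
  distrib = solve-∀

mul-x+-raise : ∀ c t f k → mul-x+ c (raise t f) k ≡ raise t (mul-x+ (c + + t) f) k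
mul-x+-raise c zero    f k       = cong (λ d → mul-x+ d f k) (sym (ℤP.+-identityʳ c))
mul-x+-raise c (suc t) f zero    = ℤP.*-zeroʳ c
mul-x+-raise c (suc t) f (suc k) =
  trans (step k) (trans (mul-x+-raise (1ℤ + c) t f k) (cong (λ d → raise t (mul-x+ d f) k) (assoc c (+ t))))
  where
  assoc : ∀ c t → (1ℤ + c) + t ≡ c + (1ℤ + t)
  assoc = solve-∀
  step : ∀ k → mul-x+ c (raise (suc t) f) (suc k) ≡ mul-x+ (1ℤ + c) (raise t f) k
  step zero    = lift c (raise t f 0)
    where
    lift : ∀ c x → 0ℤ + (c + 1ℤ) * x ≡ (1ℤ + c) * x
    lift = solve-∀
  step (suc k) = cong (λ d → raise t f k + d * raise t f (suc k)) (sym (assoc c (+ suc k)))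

translate₁-mul-x+ : ∀ c f k → translate₁ (mul-x+ c f) k ≡ mul-x+ (1ℤ + c) (translate₁ f) k
translate₁-mul-x+ c f zero    = commute c (f 0) (f 1)
  where
  commute : ∀ c x y → c * x + 1ℤ * (x + (c + 1ℤ) * y) ≡ (1ℤ + c) * (x + 1ℤ * y)
  commute = solve-∀
translate₁-mul-x+ c f (suc k) = commute c (+ suc k) (f k) (f (suc k)) (f (suc (suc k)))
  where
  commute : ∀ c s x y z → (x + (c + s) * y) + (1ℤ + s) * (y + (c + (1ℤ + s)) * z)
                        ≡ (x + s * y) + ((1ℤ + c) + s) * (y + (1ℤ + s) * z)
  commute = solve-∀

-- L(x f) = L(f(x + 1)) for the functional L((x)ₖ) = 1.
sumTo-mul-x+0 : ∀ n f → sumTo (suc n) (mul-x+ 0ℤ f) ≡ sumTo n (translate₁ f)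
sumTo-mul-x+0 n f = trans (sumTo-suc n (mul-x+ 0ℤ f)) (ℤP.+-identityˡ _)

rStirling-diagonal : ∀ c n j → rStirling c n (n ℕ.+ j) ≡ δ₀ j
rStirling-diagonal c zero    j = refl
rStirling-diagonal c (suc n) j =
  trans (cong₂ (λ x y → x + (c + + suc (n ℕ.+ j)) * y)
               (rStirling-diagonal c n j)
               (trans (cong (rStirling c n) (sym (ℕP.+-suc n j))) (rStirling-diagonal c n (suc j))))
        (trans (cong (_+_ (δ₀ j)) (ℤP.*-zeroʳ (c + + suc (n ℕ.+ j)))) (ℤP.+-identityʳ (δ₀ j)))

rStirling-vanish : ∀ c {n k} → n < k → rStirling c n k ≡ 0ℤ
rStirling-vanish c {n} n<k with ℕP.m≤n⇒∃[o]m+o≡n n<k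
... | j , refl = trans (cong (rStirling c n) (sym (ℕP.+-suc n j))) (rStirling-diagonal c n (suc j))

rStirling-column₀ : ∀ c n → rStirling c n 0 ≡ c ^ℤ n
rStirling-column₀ c zero    = refl
rStirling-column₀ c (suc n) = cong (c *_) (rStirling-column₀ c n)

rStirling-translate₁ : ∀ c n k → rStirling (1ℤ + c) n k ≡ translate₁ (rStirling c n) k
rStirling-translate₁ c zero    k =
  sym (trans (cong (_+_ (δ₀ k)) (ℤP.*-zeroʳ (+ suc k))) (ℤP.+-identityʳ (δ₀ k)))
rStirling-translate₁ c (suc n) k =
  trans (mul-x+-cong (1ℤ + c) (rStirling-translate₁ c n) k) (sym (translate₁-mul-x+ c (rStirling c n) k))

rStirling-stirling2 : ∀ n k → rStirling 0ℤ n k ≡ + stirling2 n k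
rStirling-stirling2 zero    zero    = refl
rStirling-stirling2 zero    (suc k) = refl
rStirling-stirling2 (suc n) zero    = refl
rStirling-stirling2 (suc n) (suc k) = begin
  rStirling 0ℤ n k + + suc k * rStirling 0ℤ n (suc k)
    ≡⟨ cong₂ (λ x y → x + + suc k * y) (rStirling-stirling2 n k) (rStirling-stirling2 n (suc k)) ⟩
  + stirling2 n k + + suc k * + stirling2 n (suc k)
    ≡⟨ cong (_+_ (+ stirling2 n k)) (sym (ℤP.pos-* (suc k) (stirling2 n (suc k)))) ⟩
  + stirling2 n k + + (suc k ℕ.* stirling2 n (suc k))
    ≡⟨ ℤP.+-comm (+ stirling2 n k) (+ (suc k ℕ.* stirling2 n (suc k))) ⟩
  + stirling2 (suc n) (suc k)
    ∎
  where open ≡-Reasoning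

-- (x + d + c)ⁿ = Σⱼ C(n,j) cⁿ⁻ʲ (x + d)ʲ, written as the operator (S + c)ⁿ acting on the columns.
rStirling-shiftAdd^ : ∀ d c n k → rStirling (d + c) n k ≡ shiftAdd^ c n (λ j → rStirling d j k) 0
rStirling-shiftAdd^ d c zero    k       = refl
rStirling-shiftAdd^ d c (suc n) zero    = begin
  (d + c) * rStirling (d + c) n 0
    ≡⟨ cong ((d + c) *_) (rStirling-shiftAdd^ d c n 0) ⟩
  (d + c) * shiftAdd^ c n (λ j → rStirling d j 0) 0
    ≡⟨ sym (shiftAdd^-* c (d + c) (λ j → sym (ℤP.*-distribʳ-+ (rStirling d j 0) d c)) n 0) ⟩
  shiftAdd^ c n (shiftAdd c (λ j → rStirling d j 0)) 0
    ≡⟨ sym (shiftAdd^-suc c n (λ j → rStirling d j 0) 0) ⟩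
  shiftAdd^ c (suc n) (λ j → rStirling d j 0) 0
    ∎
  where open ≡-Reasoning
rStirling-shiftAdd^ d c (suc n) (suc k) = begin
  rStirling (d + c) n k + a * rStirling (d + c) n (suc k)
    ≡⟨ cong₂ (λ x y → x + a * y) (rStirling-shiftAdd^ d c n k) (rStirling-shiftAdd^ d c n (suc k)) ⟩
  shiftAdd^ c n (column k) 0 + a * shiftAdd^ c n (column (suc k)) 0
    ≡⟨ cong (_+_ (shiftAdd^ c n (column k) 0)) (sym (shiftAdd^-* c a (λ _ → refl) n 0)) ⟩
  shiftAdd^ c n (column k) 0 + shiftAdd^ c n (λ j → a * column (suc k) j) 0
    ≡⟨ sym (shiftAdd^-+ c (λ j → regroup d c (+ suc k) (column k j) (column (suc k) j)) n 0) ⟩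
  shiftAdd^ c n (shiftAdd c (column (suc k))) 0
    ≡⟨ sym (shiftAdd^-suc c n (column (suc k)) 0) ⟩
  shiftAdd^ c (suc n) (column (suc k)) 0
    ∎
  where
  open ≡-Reasoning
  a : ℤ
  a = (d + c) + + suc k
  column : ℕ → Seq
  column k j = rStirling d j k
  regroup : ∀ d c s x y → (x + (d + s) * y) + c * y ≡ x + ((d + c) + s) * y
  regroup = solve-∀

rBell-rStirling : ∀ n c → rBell n c ≡ sumTo n (rStirling c n)
rBell-rStirling n c = begin
  sumTo n (λ j → + (n C j) * c ^ℤ (n ℕ.∸ j) * bell j)
    ≡⟨ sumTo-cong n (λ j j≤n → trans (ℤP.*-assoc (+ (n C j)) _ _)
                                     (cong (λ x → + (n C j) * (c ^ℤ (n ℕ.∸ j) * x)) (bell-sumTo j≤n))) ⟩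
  sumTo n (λ j → + (n C j) * (c ^ℤ (n ℕ.∸ j) * sumTo n (rStirling 0ℤ j)))
    ≡⟨ sumTo-cong n (λ j _ → sym (pull-out j)) ⟩
  sumTo n (λ j → sumTo n (λ k → term j k))
    ≡⟨ sumTo-comm n n term ⟩
  sumTo n (λ k → sumTo n (λ j → term j k))
    ≡⟨ sumTo-cong n (λ k _ → sym (shiftAdd^-expand c n (λ j → rStirling 0ℤ j k) 0)) ⟩
  sumTo n (λ k → shiftAdd^ c n (λ j → rStirling 0ℤ j k) 0)
    ≡⟨ sumTo-cong n (λ k _ → sym (trans (cong (λ d → rStirling d n k) (sym (ℤP.+-identityˡ c)))
                                          (rStirling-shiftAdd^ 0ℤ c n k))) ⟩
  sumTo n (rStirling c n)
    ∎
  where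
  open ≡-Reasoning
  term : ℕ → ℕ → ℤ
  term j k = + (n C j) * (c ^ℤ (n ℕ.∸ j) * rStirling 0ℤ j k)
  bell-sumTo : ∀ {j} → j ≤ n → bell j ≡ sumTo n (rStirling 0ℤ j)
  bell-sumTo {j} j≤n =
    trans (sumTo-cong j (λ k _ → sym (rStirling-stirling2 j k)))
          (sym (sumTo-extend (ℕP.≤⇒≤′ j≤n) (λ k → rStirling-vanish 0ℤ)))
  pull-out : ∀ j → sumTo n (term j) ≡ + (n C j) * (c ^ℤ (n ℕ.∸ j) * sumTo n (rStirling 0ℤ j))
  pull-out j = trans (sumTo-*ˡ n (+ (n C j)) _) (cong (+ (n C j) *_) (sumTo-*ˡ n (c ^ℤ (n ℕ.∸ j)) _))

rBell-suc : ∀ n c → rBell (suc n) c ≡ rBell n (1ℤ + c) + c * rBell n c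
rBell-suc n c = begin
  rBell (suc n) c
    ≡⟨ rBell-rStirling (suc n) c ⟩
  sumTo (suc n) (mul-x+ c f)
    ≡⟨ sumTo-cong (suc n) (λ k _ → mul-x+-split c f k) ⟩
  sumTo (suc n) (λ k → mul-x+ 0ℤ f k + c * f k)
    ≡⟨ trans (sumTo-+ (suc n) (mul-x+ 0ℤ f) (λ k → c * f k))
             (cong (_+_ (sumTo (suc n) (mul-x+ 0ℤ f))) (sumTo-*ˡ (suc n) c f)) ⟩
  sumTo (suc n) (mul-x+ 0ℤ f) + c * sumTo (suc n) f
    ≡⟨ cong₂ (λ x y → x + c * y) (sumTo-mul-x+0 n f)
                                  (sumTo-extend {n} {f = f} (≤′-step ≤′-refl) (λ k → rStirling-vanish c)) ⟩
  sumTo n (translate₁ f) + c * sumTo n f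
    ≡⟨ cong₂ (λ x y → x + c * y) (sym (sumTo-cong n (λ k _ → rStirling-translate₁ c n k)))
                                  (sym (rBell-rStirling n c)) ⟩
  sumTo n (rStirling (1ℤ + c) n) + c * rBell n c
    ≡⟨ cong (_+ c * rBell n c) (sym (rBell-rStirling n (1ℤ + c))) ⟩
  rBell n (1ℤ + c) + c * rBell n c
    ∎
  where
  open ≡-Reasoning
  f : Seq
  f = rStirling c n

module Congruence (m : ℤ) where

  -- A record rather than m ∣ x - y, so that x and y can be inferred from x ≈ y.
  infix 4 _≈_
  record _≈_ (x y : ℤ) : Set where
    constructor mk≈
    field divides-difference : m S.∣ x - y
  open _≈_ public

  ≈-refl : ∀ {x} → x ≈ x
  ≈-refl {x} = mk≈ (S.divides 0ℤ (ℤP.+-inverseʳ x))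

  ≈-sym : ∀ {x y} → x ≈ y → y ≈ x
  ≈-sym {x} {y} (mk≈ m∣x-y) = mk≈ (subst (m S.∣_) (negate x y) (S.∣m⇒∣-m m∣x-y))
    where
    negate : ∀ x y → - (x - y) ≡ y - x
    negate = solve-∀

  ≈-trans : ∀ {x y z} → x ≈ y → y ≈ z → x ≈ z
  ≈-trans {x} {y} {z} (mk≈ m∣x-y) (mk≈ m∣y-z) =
    mk≈ (subst (m S.∣_) (ℤP.+-minus-telescope x y z) (S.∣m∣n⇒∣m+n m∣x-y m∣y-z))

  ≈-isEquivalence : IsEquivalence _≈_
  ≈-isEquivalence = record { refl = ≈-refl ; sym = ≈-sym ; trans = ≈-trans }

  ≈-setoid : Setoid _ _
  ≈-setoid = record { isEquivalence = ≈-isEquivalence }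

  ≡⇒≈ : ∀ {x y} → x ≡ y → x ≈ y
  ≡⇒≈ refl = ≈-refl

  ∣⇒≈0 : ∀ {x} → m S.∣ x → x ≈ 0ℤ
  ∣⇒≈0 {x} m∣x = mk≈ (subst (m S.∣_) (sym (ℤP.+-identityʳ x)) m∣x)

  +-multiple≈ : ∀ x y → x + y * m ≈ x
  +-multiple≈ x y = mk≈ (S.divides y (cancel x y m))
    where
    cancel : ∀ x y m → (x + y * m) - x ≡ y * m
    cancel = solve-∀

  +-cong≈ : ∀ {x y u v} → x ≈ y → u ≈ v → x + u ≈ y + v
  +-cong≈ {x} {y} {u} {v} (mk≈ m∣x-y) (mk≈ m∣u-v) =
    mk≈ (subst (m S.∣_) (regroup x y u v) (S.∣m∣n⇒∣m+n m∣x-y m∣u-v))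
    where
    regroup : ∀ x y u v → (x - y) + (u - v) ≡ (x + u) - (y + v)
    regroup = solve-∀

  +-congˡ≈ : ∀ c {x y} → x ≈ y → c + x ≈ c + y
  +-congˡ≈ c = +-cong≈ (≈-refl {c})

  *-congˡ≈ : ∀ c {x y} → x ≈ y → c * x ≈ c * y
  *-congˡ≈ c {x} {y} (mk≈ m∣x-y) = mk≈ (subst (m S.∣_) (distrib c x y) (S.∣n⇒∣m*n c m∣x-y))
    where
    distrib : ∀ c x y → c * (x - y) ≡ c * x - c * y
    distrib = solve-∀

  *-congʳ≈ : ∀ c {x y} → x ≈ y → x * c ≈ y * c
  *-congʳ≈ c {x} {y} x≈y = subst₂ _≈_ (ℤP.*-comm c x) (ℤP.*-comm c y) (*-congˡ≈ c x≈y)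

  +-cancelˡ≈ : ∀ {a b x y} → a ≈ b → a + x ≈ b + y → x ≈ y
  +-cancelˡ≈ {a} {b} {x} {y} (mk≈ m∣a-b) (mk≈ m∣ax-by) =
    mk≈ (subst (m S.∣_) (cancel a b x y) (S.∣m∣n⇒∣m-n m∣ax-by m∣a-b))
    where
    cancel : ∀ a b x y → ((a + x) - (b + y)) - (a - b) ≡ x - y
    cancel = solve-∀

  sumTo-cong≈ : ∀ n {f g : ℕ → ℤ} → (∀ i → i ≤ n → f i ≈ g i) → sumTo n f ≈ sumTo n g
  sumTo-cong≈ zero    f≈g = f≈g 0 z≤n
  sumTo-cong≈ (suc n) f≈g =
    +-cong≈ (sumTo-cong≈ n (λ i i≤n → f≈g i (ℕP.m≤n⇒m≤1+n i≤n))) (f≈g (suc n) ℕP.≤-refl)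

  ShiftRelation : ℕ → ℤ → Seq → Set
  ShiftRelation t s b = ∀ j → b (j ℕ.+ t) ≈ shiftAdd s b j

  ShiftRelation-power : ∀ {t s b} → ShiftRelation t s b →
                        ∀ k j → b (j ℕ.+ k ℕ.* t) ≈ shiftAdd^ s k b j
  ShiftRelation-power {b = b} rel zero    j = ≡⇒≈ (cong b (ℕP.+-identityʳ j))
  ShiftRelation-power {t} {s} {b} rel (suc k) j = begin
    b (j ℕ.+ (t ℕ.+ k ℕ.* t))
      ≡⟨ cong b (trans (cong (j ℕ.+_) (ℕP.+-comm t (k ℕ.* t))) (sym (ℕP.+-assoc j (k ℕ.* t) t))) ⟩
    b (j ℕ.+ k ℕ.* t ℕ.+ t)
      ≈⟨ rel (j ℕ.+ k ℕ.* t) ⟩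
    b (suc j ℕ.+ k ℕ.* t) + s * b (j ℕ.+ k ℕ.* t)
      ≈⟨ +-cong≈ (ShiftRelation-power rel k (suc j)) (*-congˡ≈ s (ShiftRelation-power rel k j)) ⟩
    shiftAdd^ s (suc k) b j
      ∎
    where open ≈-Reasoning ≈-setoid

  mul-x+-cong≈ : ∀ c {f g : Seq} → (∀ k → f k ≈ g k) → ∀ k → mul-x+ c f k ≈ mul-x+ c g k
  mul-x+-cong≈ c f≈g zero    = *-congˡ≈ c (f≈g 0)
  mul-x+-cong≈ c f≈g (suc k) = +-cong≈ (f≈g k) (*-congˡ≈ (c + + suc k) (f≈g (suc k)))

  mul-x+-+multiple≈ : ∀ c f k → mul-x+ (c + m) f k ≈ mul-x+ c f k
  mul-x+-+multiple≈ c f k = begin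
    mul-x+ (c + m) f k                    ≡⟨ mul-x+-split (c + m) f k ⟩
    mul-x+ 0ℤ f k + (c + m) * f k         ≡⟨ regroup (mul-x+ 0ℤ f k) c m (f k) ⟩
    (mul-x+ 0ℤ f k + c * f k) + f k * m   ≈⟨ +-multiple≈ _ (f k) ⟩
    mul-x+ 0ℤ f k + c * f k               ≡⟨ sym (mul-x+-split c f k) ⟩
    mul-x+ c f k                          ∎
    where
    open ≈-Reasoning ≈-setoid
    regroup : ∀ x c m y → x + (c + m) * y ≡ (x + c * y) + y * m
    regroup = solve-∀

  raise-cong≈ : ∀ t {f g : Seq} → (∀ k → f k ≈ g k) → ∀ k → raise t f k ≈ raise t g k
  raise-cong≈ zero    f≈g k       = f≈g k
  raise-cong≈ (suc t) f≈g zero    = ≈-refl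
  raise-cong≈ (suc t) f≈g (suc k) = raise-cong≈ t f≈g k

-- The prime is written 2 + q so that sums up to p unfold by pattern matching.
module ModuloPrime (q : ℕ) (p-prime : Prime (2 ℕ.+ q)) where

  p : ℕ
  p = 2 ℕ.+ q

  open Congruence (+ p) public

  p∣pC[i+1] : ∀ i → suc i < p → p ℕD.∣ p C suc i
  p∣pC[i+1] i i<p =
    ℕC.coprime-divisor (ℕC.prime⇒coprime p-prime i<p)
      (subst (p ℕD.∣_) (sym ([k+1]*[n+1]C[k+1]≡[n+1]*nCk (suc q) i)) (ℕD.m∣m*n (suc q C i)))

  *-cancelˡ≈ : ∀ a {x y} → suc a < p → + suc a * x ≈ + suc a * y → x ≈ y
  *-cancelˡ≈ a {x} {y} a<p (mk≈ p∣ax-ay) =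
    mk≈ (S.∣ᵤ⇒∣ (ℤC.coprime-divisor (+ p) (+ suc a) (x - y) (ℕC.prime⇒coprime p-prime a<p)
                   (S.∣⇒∣ᵤ (subst (+ p S.∣_) (factor (+ suc a) x y) p∣ax-ay))))
    where
    factor : ∀ a x y → a * x - a * y ≡ a * (x - y)
    factor = solve-∀

  frobenius : ∀ s b j → shiftAdd^ s p b j ≈ b (j ℕ.+ p) + s ^ℤ p * b j
  frobenius s b j = begin
    shiftAdd^ s p b j
      ≡⟨ shiftAdd^-expand s p b j ⟩
    sumTo p term
      ≡⟨ sumTo-suc (suc q) term ⟩
    term 0 + (sumTo q (term ∘ suc) + term p)
      ≈⟨ +-congˡ≈ (term 0) (+-cong≈ inner≈0 (≈-refl {term p})) ⟩
    term 0 + (0ℤ + term p)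
      ≡⟨ cong₂ (λ u v → u + (0ℤ + v)) first last ⟩
    s ^ℤ p * b j + (0ℤ + b (j ℕ.+ p))
      ≡⟨ cong (_+_ (s ^ℤ p * b j)) (ℤP.+-identityˡ _) ⟩
    s ^ℤ p * b j + b (j ℕ.+ p)
      ≡⟨ ℤP.+-comm (s ^ℤ p * b j) _ ⟩
    b (j ℕ.+ p) + s ^ℤ p * b j
      ∎
    where
    open ≈-Reasoning ≈-setoid
    term : ℕ → ℤ
    term i = + (p C i) * (s ^ℤ (p ℕ.∸ i) * b (j ℕ.+ i))
    inner≈0 : sumTo q (term ∘ suc) ≈ 0ℤ
    inner≈0 = ≈-trans (sumTo-cong≈ q (λ i i≤q → ∣⇒≈0 (S.∣m⇒∣m*n _ (p∣pC[i+1]′ i≤q))))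
                      (≡⇒≈ (sumTo-0ℤ q))
      where
      p∣pC[i+1]′ : ∀ {i} → i ≤ q → + p S.∣ + (p C suc i)
      p∣pC[i+1]′ {i} i≤q = S.∣ᵤ⇒∣ (p∣pC[i+1] i (s≤s (s≤s i≤q)))
    first : term 0 ≡ s ^ℤ p * b j
    first = trans (ℤP.*-identityˡ _) (cong (λ k → s ^ℤ p * b k) (ℕP.+-identityʳ j))
    last : term p ≡ b (j ℕ.+ p)
    last = trans (cong₂ (λ c e → + c * (s ^ℤ e * b (j ℕ.+ p))) (nCn≡1 p) (ℕP.n∸n≡0 p))
                 (trans (ℤP.*-identityˡ _) (ℤP.*-identityˡ _))

  [1+k]^p≈1+k^p : ∀ k → (1ℤ + k) ^ℤ p ≈ 1ℤ + k ^ℤ p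
  [1+k]^p≈1+k^p k = begin
    (1ℤ + k) ^ℤ p                       ≡⟨ sym (trans (shiftAdd^-geometric 1ℤ k p 0) (ℤP.*-identityʳ _)) ⟩
    shiftAdd^ 1ℤ p (k ^ℤ_) 0            ≈⟨ frobenius 1ℤ (k ^ℤ_) 0 ⟩
    k ^ℤ p + 1ℤ ^ℤ p * 1ℤ               ≡⟨ cong (_+_ (k ^ℤ p)) (trans (ℤP.*-identityʳ _) (ℤP.^-zeroˡ p)) ⟩
    k ^ℤ p + 1ℤ                         ≡⟨ ℤP.+-comm (k ^ℤ p) 1ℤ ⟩
    1ℤ + k ^ℤ p                         ∎
    where open ≈-Reasoning ≈-setoid

  fermat : ∀ k → k ^ℤ p ≈ k
  fermat (+ zero)        = ≈-refl
  fermat (+ suc n)       = ≈-trans ([1+k]^p≈1+k^p (+ n)) (+-congˡ≈ 1ℤ (fermat (+ n)))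
  fermat -[1+ zero ]     = +-cancelˡ≈ (≈-refl {1ℤ}) (≈-sym ([1+k]^p≈1+k^p -[1+ zero ]))
  fermat -[1+ suc n ]    =
    +-cancelˡ≈ (≈-refl {1ℤ}) (≈-trans (≈-sym ([1+k]^p≈1+k^p -[1+ suc n ])) (fermat -[1+ n ]))

  ShiftRelation-p^ : ∀ {b} → ShiftRelation p 1ℤ b → ∀ s → ShiftRelation (p ^ s) (+ s) b
  ShiftRelation-p^ {b} touchard zero    j =
    ≡⇒≈ (trans (cong b (ℕP.+-comm j 1)) (sym (ℤP.+-identityʳ (b (suc j)))))
  ShiftRelation-p^ {b} touchard (suc s) j = begin
    b (j ℕ.+ p ℕ.* p ^ s)                  ≈⟨ ShiftRelation-power {b = b} (ShiftRelation-p^ {b} touchard s) p j ⟩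
    shiftAdd^ (+ s) p b j                  ≈⟨ frobenius (+ s) b j ⟩
    b (j ℕ.+ p) + (+ s) ^ℤ p * b j         ≈⟨ +-cong≈ (touchard j) (*-congʳ≈ (b j) (fermat (+ s))) ⟩
    (b (suc j) + 1ℤ * b j) + + s * b j     ≡⟨ collect (b (suc j)) (b j) (+ s) ⟩
    b (suc j) + + suc s * b j              ∎
    where
    open ≈-Reasoning ≈-setoid
    collect : ∀ x y s → (x + 1ℤ * y) + s * y ≡ x + (1ℤ + s) * y
    collect = solve-∀

  -- Translating c by 1 acts on the k-th coefficient as a difference operator, so Fermat's
  -- c ^ p ≡ c for the constant coefficient propagates to every k < p (dividing by k + 1 < p).
  rStirling-p≈1 : ∀ {k} → k < p → ∀ c → rStirling c p k ≈ rStirling c 1 k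
  rStirling-p≈1 {zero}  _   c = begin
    rStirling c p 0   ≡⟨ rStirling-column₀ c p ⟩
    c ^ℤ p            ≈⟨ fermat c ⟩
    c                 ≡⟨ sym (ℤP.*-identityʳ c) ⟩
    rStirling c 1 0   ∎
    where open ≈-Reasoning ≈-setoid
  rStirling-p≈1 {suc k} k<p c = *-cancelˡ≈ k k<p (+-cancelˡ≈ (rStirling-p≈1 (ℕP.<⇒≤ k<p) c) (begin
    rStirling c p k + + suc k * rStirling c p (suc k)   ≡⟨ sym (rStirling-translate₁ c p k) ⟩
    rStirling (1ℤ + c) p k                              ≈⟨ rStirling-p≈1 (ℕP.<⇒≤ k<p) (1ℤ + c) ⟩
    rStirling (1ℤ + c) 1 k                              ≡⟨ rStirling-translate₁ c 1 k ⟩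
    rStirling c 1 k + + suc k * rStirling c 1 (suc k)   ∎))
    where open ≈-Reasoning ≈-setoid

  rStirling-p≈1+raise : ∀ c k → rStirling c p k ≈ rStirling c 1 k + raise p δ₀ k
  rStirling-p≈1+raise c k with k ℕ.<? p
  ... | yes k<p = ≈-trans (rStirling-p≈1 k<p c)
                          (≡⇒≈ (sym (trans (cong (_+_ (rStirling c 1 k)) (raise-below p δ₀ k<p)) (ℤP.+-identityʳ _))))
  ... | no k≮p with ℕP.m≤n⇒∃[o]m+o≡n (ℕP.≮⇒≥ k≮p)
  ...   | j , refl = ≡⇒≈ (trans (rStirling-diagonal c p j)
                                (sym (trans (cong₂ _+_ (rStirling-diagonal c 1 (suc (q ℕ.+ j))) (raise-above p δ₀ j))
                                            (ℤP.+-identityˡ (δ₀ j)))))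

  rStirling-touchard : ∀ c n k → rStirling c (n ℕ.+ p) k ≈ rStirling c (suc n) k + raise p (rStirling c n) k
  rStirling-touchard c zero    k = rStirling-p≈1+raise c k
  rStirling-touchard c (suc n) k = begin
    mul-x+ c (rStirling c (n ℕ.+ p)) k
      ≈⟨ mul-x+-cong≈ c (rStirling-touchard c n) k ⟩
    mul-x+ c (λ i → rStirling c (suc n) i + raise p (rStirling c n) i) k
      ≡⟨ mul-x+-+ c (rStirling c (suc n)) (raise p (rStirling c n)) k ⟩
    rStirling c (2 ℕ.+ n) k + mul-x+ c (raise p (rStirling c n)) k
      ≡⟨ cong (_+_ (rStirling c (2 ℕ.+ n) k)) (mul-x+-raise c p (rStirling c n) k) ⟩
    rStirling c (2 ℕ.+ n) k + raise p (mul-x+ (c + + p) (rStirling c n)) k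
      ≈⟨ +-congˡ≈ (rStirling c (2 ℕ.+ n) k) (raise-cong≈ p (mul-x+-+multiple≈ c (rStirling c n)) k) ⟩
    rStirling c (2 ℕ.+ n) k + raise p (rStirling c (suc n)) k
      ∎
    where open ≈-Reasoning ≈-setoid

  rBell-touchard : ∀ c → ShiftRelation p 1ℤ (λ n → rBell n c)
  rBell-touchard c n = begin
    rBell (n ℕ.+ p) c
      ≡⟨ rBell-rStirling (n ℕ.+ p) c ⟩
    sumTo (n ℕ.+ p) (rStirling c (n ℕ.+ p))
      ≈⟨ sumTo-cong≈ (n ℕ.+ p) (λ k _ → rStirling-touchard c n k) ⟩
    sumTo (n ℕ.+ p) (λ k → rStirling c (suc n) k + raise p (rStirling c n) k)
      ≡⟨ sumTo-+ (n ℕ.+ p) (rStirling c (suc n)) (raise p (rStirling c n)) ⟩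
    sumTo (n ℕ.+ p) (rStirling c (suc n)) + sumTo (n ℕ.+ p) (raise p (rStirling c n))
      ≡⟨ cong₂ _+_ (sumTo-extend (ℕP.≤⇒≤′ (ℕP.m<m+n n (s≤s z≤n))) (λ k → rStirling-vanish c))
                   (trans (cong (λ t → sumTo t (raise p (rStirling c n))) (ℕP.+-comm n p))
                          (sumTo-raise p n (rStirling c n))) ⟩
    sumTo (suc n) (rStirling c (suc n)) + sumTo n (rStirling c n)
      ≡⟨ cong₂ _+_ (sym (rBell-rStirling (suc n) c))
                   (sym (trans (ℤP.*-identityˡ (rBell n c)) (rBell-rStirling n c))) ⟩
    rBell (suc n) c + 1ℤ * rBell n c
      ∎
    where open ≈-Reasoning ≈-setoid

proposition1 : (p n r : ℕ) → Prime p →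
    (+ p) ∣ (rBell (n ℕ.+ p ^ r) (- (+ r)) - rBell n (+ 1 - + r))
proposition1 p n r p-prime with nonTrivial⇒n>1 p ⦃ prime⇒nonTrivial p-prime ⦄
proposition1 (suc (suc q)) n r p-prime | s≤s (s≤s _) = S.∣⇒∣ᵤ (divides-difference (begin
  rBell (n ℕ.+ p ^ r) c
    ≈⟨ ShiftRelation-p^ {λ m → rBell m c} (rBell-touchard c) r n ⟩
  rBell (suc n) c + + r * rBell n c
    ≡⟨ cong (_+ + r * rBell n c) (rBell-suc n c) ⟩
  (rBell n (1ℤ + c) + c * rBell n c) + + r * rBell n c
    ≡⟨ cancel (rBell n (1ℤ + c)) (rBell n c) (+ r) ⟩
  rBell n (1ℤ + c)
    ∎))
  where
  open ModuloPrime q p-prime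
  open ≈-Reasoning ≈-setoid
  c : ℤ
  c = - (+ r)
  cancel : ∀ x y r → (x + (- r) * y) + r * y ≡ x
  cancel = solve-∀
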